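{- The reduction relation $\to_{j/obox}$ is terminating.
   Context: $\lambda j$-terms: $t,u ::= x \mid \lambda x.t \mid t\,u \mid t[x/u]$; $[x/u]$ is a jump, $\lambda x.t$ and $t[x/u]$ bind $x$ in $t$ (not in $u$), terms modulo $\alpha$-conversion. $\mathrm{fv}(t)$ free variables, $|t|_x$ number of free occurrences of $x$, $t\{x/u\}$ capture-avoiding substitution. When $|t|_x\ge2$, $t_{[y]_x}$ is any term obtained by renaming $i$ free occurrences of $x$ into a fresh $y$, $1\le i\le|t|_x-1$. $\to_j$ is the contextual closure of (w) $t[x/u]\mapsto t$ if $|t|_x=0$; (d) $t[x/u]\mapsto t\{x/u\}$ if $|t|_x=1$; (c) $t[x/u]\mapsto t_{[y]_x}[x/u][y/u]$ if $|t|_x>1$, $y$ fresh. $\equiv_{obox}$ is the smallest equivalence closed under contexts containing: $t[x/s][y/v]\sim t[y/v][x/s]$ if $x\notin\mathrm{fv}(v)$, $y\notin\mathrm{fv}(s)$; $\lambda y.(t[x/s])\sim(\lambda y.t)[x/s]$ if $y\notin\mathrm{fv}(s)$; $t[x/s]\,v\sim(t\,v)[x/s]$ if $x\notin\mathrm{fv}(v)$; $(t\,v)[x/u]\sim t\,(v[x/u])$ if $x\notin\mathrm{fv}(t)$, $x\in\mathrm{fv}(v)$; $t[y/v][x/u]\sim t[y/v[x/u]]$ if $x\notin\mathrm{fv}(t)$, $x\in\mathrm{fv}(v)$. $t\to_{j/obox}u$ iff $t\equiv_{obox}t'\to_j u'\equiv_{obox}u$. Terminating: no infinite reduction sequence.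 -}

module Defs where

open import Data.Nat using (ℕ; zero; suc; _+_; _∸_; _≤_; _<_)
open import Data.Nat using (_≟_)
open import Data.Product using (Σ; ∃; _×_; _,_)
open import Relation.Nullary using (¬_; yes; no)
open import Relation.Binary.PropositionalEquality using (_≡_)
open import Relation.Binary.Construct.Closure.Equivalence using (EqClosure)

-- λj-terms, de Bruijn indices (terms modulo α-conversion).
-- sub t u  represents  t[x/u], binding index 0 of t (not binding in u).
data Term : Set where
  var : ℕ → Term
  lam : Term → Term
  app : Term → Term → Term
  sub : Term → Term → Term

Ren : Set
Ren = ℕ → ℕ

ext : Ren → Ren
ext ρ zero    = zero
ext ρ (suc n) = suc (ρ n)

extN : ℕ → Ren → Ren
extN zero    ρ = ρ
extN (suc k) ρ = ext (extN k ρ)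

rename : Ren → Term → Term
rename ρ (var n)   = var (ρ n)
rename ρ (lam t)   = lam (rename (ext ρ) t)
rename ρ (app t u) = app (rename ρ t) (rename ρ u)
rename ρ (sub t u) = sub (rename (ext ρ) t) (rename ρ u)

shift : Term → Term
shift = rename suc

swapR : Ren
swapR zero          = suc zero
swapR (suc zero)    = zero
swapR (suc (suc n)) = suc (suc n)

swap01 : Term → Term
swap01 = rename swapR

Subst : Set
Subst = ℕ → Term

exts : Subst → Subst
exts σ zero    = var zero
exts σ (suc n) = shift (σ n)

subst : Subst → Term → Term
subst σ (var n)   = σ n
subst σ (lam t)   = lam (subst (exts σ) t)
subst σ (app t u) = app (subst σ t) (subst σ u)
subst σ (sub t u) = sub (subst (exts σ) t) (subst σ u)

single : Term → Subst
single u zero    = u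
single u (suc n) = var n

_⟨0≔_⟩ : Term → Term → Term
t ⟨0≔ u ⟩ = subst (single u) t

count : ℕ → Term → ℕ
count k (var n) with n ≟ k
... | yes _ = 1
... | no  _ = 0
count k (lam t)   = count (suc k) t
count k (app t u) = count k t + count k u
count k (sub t u) = count (suc k) t + count k u

_∈fv_ : ℕ → Term → Set
k ∈fv t = 1 ≤ count k t

-- Split k t t' i : under k binders, x = index k of t; t' is t with a fresh
-- variable y inserted just above x (index k+1 in t'), and exactly i free
-- occurrences of x renamed into y.
data Split : ℕ → Term → Term → ℕ → Set where
  sp-keep : ∀ {k n} → Split k (var n) (var (extN k (ext suc) n)) 0
  sp-ren  : ∀ {k} → Split k (var k) (var (suc k)) 1
  sp-lam  : ∀ {k t t' i} → Split (suc k) t t' i → Split k (lam t) (lam t') i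
  sp-app  : ∀ {k t t' u u' i j} → Split k t t' i → Split k u u' j →
            Split k (app t u) (app t' u') (i + j)
  sp-sub  : ∀ {k t t' u u' i j} → Split (suc k) t t' i → Split k u u' j →
            Split k (sub t u) (sub t' u') (i + j)

data _↦j_ : Term → Term → Set where
  rule-w : ∀ {t u} → sub (shift t) u ↦j t
  rule-d : ∀ {t u} → count 0 t ≡ 1 → sub t u ↦j (t ⟨0≔ u ⟩)
  rule-c : ∀ {t t' u i} → 1 < count 0 t → Split 0 t t' i →
           1 ≤ i → i ≤ count 0 t ∸ 1 →
           sub t u ↦j sub (sub t' (shift u)) u

data _→j_ : Term → Term → Set where
  root  : ∀ {t u} → t ↦j u → t →j u
  lamC  : ∀ {t t'} → t →j t' → lam t →j lam t'
  appL  : ∀ {t t' u} → t →j t' → app t u →j app t' u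
  appR  : ∀ {t u u'} → u →j u' → app t u →j app t u'
  subL  : ∀ {t t' u} → t →j t' → sub t u →j sub t' u
  subR  : ∀ {t u u'} → u →j u' → sub t u →j sub t u'

-- axioms of ≡obox (de Bruijn rendering; side conditions "y ∉ fv(s)",
-- "x ∉ fv(t)" etc. are expressed by the term being a weakening)
data _∼_ : Term → Term → Set where
  -- t[x/s][y/v] ∼ t[y/v][x/s]   (x ∉ fv v, y ∉ fv s)
  ax-exch : ∀ {t s v} → sub (sub t (shift s)) v ∼ sub (sub (swap01 t) (shift v)) s
  -- λy.(t[x/s]) ∼ (λy.t)[x/s]   (y ∉ fv s)
  ax-lam  : ∀ {t s} → lam (sub t (shift s)) ∼ sub (lam (swap01 t)) s
  -- t[x/s] v ∼ (t v)[x/s]   (x ∉ fv v)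
  ax-appL : ∀ {t s v} → app (sub t s) v ∼ sub (app t (shift v)) s
  -- (t v)[x/u] ∼ t (v[x/u])   (x ∉ fv t, x ∈ fv v)
  ax-appR : ∀ {t v u} → 0 ∈fv v → sub (app (shift t) v) u ∼ app t (sub v u)
  -- t[y/v][x/u] ∼ t[y/v[x/u]]   (x ∉ fv t, x ∈ fv v)
  ax-box  : ∀ {t v u} → 0 ∈fv v →
            sub (sub (rename (ext suc) t) v) u ∼ sub t (sub v u)

data _∼C_ : Term → Term → Set where
  rootC : ∀ {t u} → t ∼ u → t ∼C u
  lamC  : ∀ {t t'} → t ∼C t' → lam t ∼C lam t'
  appL  : ∀ {t t' u} → t ∼C t' → app t u ∼C app t' u
  appR  : ∀ {t u u'} → u ∼C u' → app t u ∼C app t u'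
  subL  : ∀ {t t' u} → t ∼C t' → sub t u ∼C sub t' u
  subR  : ∀ {t u u'} → u ∼C u' → sub t u ∼C sub t u'

_≡obox_ : Term → Term → Set
_≡obox_ = EqClosure _∼C_

_→j/obox_ : Term → Term → Set
t →j/obox u = Σ Term λ t' → Σ Term λ u' →
  (t ≡obox t') × (t' →j u') × (u' ≡obox u)

Terminating : (Term → Term → Set) → Set
Terminating _⇒_ = ¬ (Σ (ℕ → Term) λ f → ∀ n → f n ⇒ f (suc n))

module Submission where

-- A jump t[x/u] eventually makes one copy of u for each occurrence of x in t,
-- an occurrence inside the argument of another jump counting once per copy of
-- that argument.  Let μ add up, over all jumps, (1 + μ u) times the square of
-- the number of copies of u.  Rules (w) and (d) remove a jump without increasing
-- the number of copies of any other argument, and (c) splits p + q copies into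
-- p and q copies with p, q ≥ 1, where p² + q² < (p + q)².  The ≡obox axioms
-- preserve μ: they only move jumps, and the box axiom turns the m n copies of u
-- made by one jump into n copies inside an argument copied m times, where
-- (m n)² = m² n².

open import Defs
open import Data.Nat
  using (ℕ; zero; suc; _+_; _*_; _∸_; _⊔_; _≤_; _<_; z≤n; s≤s; _≟_; >-nonZero)
open import Data.Nat.Properties
open import Data.Nat.Induction using (<-wellFounded)
open import Algebra.Properties.CommutativeSemigroup +-commutativeSemigroup
  using () renaming (interchange to +-interchange; xy∙z≈xz∙y to +-rightComm)
open import Data.Nat.Tactic.RingSolver using (solve-∀)
open import Data.Product using (_,_)
open import Function using (_∘_)
open import Function.Definitions using (Injective)
open import Induction.WellFounded using (Acc; acc)
open import Induction.InfiniteDescent using (InfiniteDescendingSequence)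
open import Relation.Binary using (Rel; IsEquivalence)
open import Relation.Binary.Construct.Closure.Equivalence using (fold)
open import Relation.Binary.PropositionalEquality
  using (_≡_; _≢_; refl; sym; trans; cong; cong₂) renaming (subst to ≡-subst)
open import Relation.Nullary using (¬_; yes; no; contradiction)

infix 8 _²

_² : ℕ → ℕ
n ² = n * n

-- With the factor 1 ⊔ _, a jump whose variable does not occur still counts as
-- one copy of its argument.
occ : ℕ → Term → ℕ
occ k (var n)   = count k (var n)
occ k (lam t)   = occ (suc k) t
occ k (app t u) = occ k t + occ k u
occ k (sub t u) = occ (suc k) t + (1 ⊔ occ 0 t) * occ k u

occSq : ℕ → Term → ℕ
occSq k (var n)   = count k (var n)
occSq k (lam t)   = occSq (suc k) t
occSq k (app t u) = occSq k t + occSq k u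
occSq k (sub t u) = occSq (suc k) t + (1 ⊔ occ 0 t) ² * occSq k u

μ : Term → ℕ
μ (var n)   = 0
μ (lam t)   = μ t
μ (app t u) = μ t + μ u
μ (sub t u) = μ t + (1 ⊔ occ 0 t) ² * suc (μ u)

n≤n² : ∀ n → n ≤ n ²
n≤n² zero    = z≤n
n≤n² (suc n) = m≤m*n (suc n) (suc n)

²-+-expand : ∀ m n → (m + n) * (m + n) ≡ m * m + n * n + 2 * (m * n)
²-+-expand = solve-∀

²-+-≤ : ∀ m n → m ² + n ² ≤ (m + n) ²
²-+-≤ m n = ≤-trans (m≤m+n (m ² + n ²) _) (≤-reflexive (sym (²-+-expand m n)))

²-+-< : ∀ {m n} → 1 ≤ m → 1 ≤ n → m ² + n ² < (m + n) ²
²-+-< {m@(suc _)} {n@(suc _)} _ _ =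
  <-≤-trans (m<m+n (m ² + n ²) (s≤s z≤n)) (≤-reflexive (sym (²-+-expand m n)))

n≤[1⊔m]*n : ∀ m n → n ≤ (1 ⊔ m) * n
n≤[1⊔m]*n m n = ≤-trans (≤-reflexive (sym (*-identityˡ n))) (*-monoˡ-≤ n (m≤m⊔n 1 m))

[1⊔m]²*-monoʳ-< : ∀ m {x y} → x < y → (1 ⊔ m) ² * x < (1 ⊔ m) ² * y
[1⊔m]²*-monoʳ-< m = *-monoʳ-< ((1 ⊔ m) ²) {{>-nonZero (*-mono-≤ (m≤m⊔n 1 m) (m≤m⊔n 1 m))}}

[1⊔-]²-mono : ∀ {m n} → m ≤ n → (1 ⊔ m) ² ≤ (1 ⊔ n) ²
[1⊔-]²-mono m≤n = *-mono-≤ (⊔-monoʳ-≤ 1 m≤n) (⊔-monoʳ-≤ 1 m≤n)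

count-var-self : ∀ k → count k (var k) ≡ 1
count-var-self k with k ≟ k
... | yes _   = refl
... | no k≢k = contradiction refl k≢k

count-var-other : ∀ {n k} → n ≢ k → count k (var n) ≡ 0
count-var-other {n} {k} n≢k with n ≟ k
... | yes n≡k = contradiction n≡k n≢k
... | no _    = refl

count-var-rename : ∀ {ρ} → Injective _≡_ _≡_ ρ →
                   ∀ n k → count (ρ k) (var (ρ n)) ≡ count k (var n)
count-var-rename {ρ} ρ-inj n k with n ≟ k
... | yes refl = count-var-self (ρ n)
... | no n≢k   = count-var-other (n≢k ∘ ρ-inj)

count-var-suc : ∀ n k → count (suc k) (var (suc n)) ≡ count k (var n)
count-var-suc = count-var-rename suc-injective

count≤occ : ∀ k t → count k t ≤ occ k t
count≤occ k (var n)   = ≤-refl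
count≤occ k (lam t)   = count≤occ (suc k) t
count≤occ k (app t u) = +-mono-≤ (count≤occ k t) (count≤occ k u)
count≤occ k (sub t u) =
  +-mono-≤ (count≤occ (suc k) t) (≤-trans (count≤occ k u) (n≤[1⊔m]*n (occ 0 t) (occ k u)))

ext-injective : ∀ {ρ} → Injective _≡_ _≡_ ρ → Injective _≡_ _≡_ (ext ρ)
ext-injective ρ-inj {zero}  {zero}  _ = refl
ext-injective ρ-inj {suc m} {suc n} e = cong suc (ρ-inj (suc-injective e))

extN-injective : ∀ k {ρ} → Injective _≡_ _≡_ ρ → Injective _≡_ _≡_ (extN k ρ)
extN-injective zero    ρ-inj = ρ-inj
extN-injective (suc k) ρ-inj = ext-injective (extN-injective k ρ-inj)

ext-avoids : ∀ {ρ k} → (∀ n → ρ n ≢ k) → ∀ n → ext ρ n ≢ suc k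
ext-avoids avoid zero    ()
ext-avoids avoid (suc n) e = avoid n (suc-injective e)

occ-rename : ∀ {ρ} → Injective _≡_ _≡_ ρ → ∀ t k → occ (ρ k) (rename ρ t) ≡ occ k t
occ-rename ρ-inj (var n)   k = count-var-rename ρ-inj n k
occ-rename ρ-inj (lam t)   k = occ-rename (ext-injective ρ-inj) t (suc k)
occ-rename ρ-inj (app t u) k = cong₂ _+_ (occ-rename ρ-inj t k) (occ-rename ρ-inj u k)
occ-rename ρ-inj (sub t u) k
  rewrite occ-rename (ext-injective ρ-inj) t (suc k) | occ-rename (ext-injective ρ-inj) t 0
        | occ-rename ρ-inj u k = refl

occ-rename-avoiding : ∀ {ρ} t k → (∀ n → ρ n ≢ k) → occ k (rename ρ t) ≡ 0
occ-rename-avoiding (var n)   k avoid = count-var-other (avoid n)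
occ-rename-avoiding (lam t)   k avoid = occ-rename-avoiding t (suc k) (ext-avoids avoid)
occ-rename-avoiding (app t u) k avoid =
  cong₂ _+_ (occ-rename-avoiding t k avoid) (occ-rename-avoiding u k avoid)
occ-rename-avoiding {ρ} (sub t u) k avoid
  rewrite occ-rename-avoiding t (suc k) (ext-avoids avoid) | occ-rename-avoiding u k avoid =
  *-zeroʳ (1 ⊔ occ 0 (rename (ext ρ) t))

μ-rename : ∀ {ρ} → Injective _≡_ _≡_ ρ → ∀ t → μ (rename ρ t) ≡ μ t
μ-rename ρ-inj (var n)   = refl
μ-rename ρ-inj (lam t)   = μ-rename (ext-injective ρ-inj) t
μ-rename ρ-inj (app t u) = cong₂ _+_ (μ-rename ρ-inj t) (μ-rename ρ-inj u)
μ-rename ρ-inj (sub t u)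
  rewrite μ-rename (ext-injective ρ-inj) t | occ-rename (ext-injective ρ-inj) t 0
        | μ-rename ρ-inj u = refl

occ-zero-shift : ∀ t → occ 0 (shift t) ≡ 0
occ-zero-shift t = occ-rename-avoiding t 0 (λ _ ())

occ-suc-shift : ∀ t k → occ (suc k) (shift t) ≡ occ k t
occ-suc-shift = occ-rename suc-injective

μ-shift : ∀ t → μ (shift t) ≡ μ t
μ-shift = μ-rename suc-injective

swapR-involutive : ∀ n → swapR (swapR n) ≡ n
swapR-involutive zero          = refl
swapR-involutive (suc zero)    = refl
swapR-involutive (suc (suc n)) = refl

swapR-injective : Injective _≡_ _≡_ swapR
swapR-injective {m} {n} e =
  trans (sym (swapR-involutive m)) (trans (cong swapR e) (swapR-involutive n))

shiftN : ℕ → Term → Term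
shiftN zero    u = u
shiftN (suc k) u = shift (shiftN k u)

extsN : ℕ → Subst → Subst
extsN zero    σ = σ
extsN (suc k) σ = exts (extsN k σ)

occ-subst-var : ∀ u k n j →
  occ j (extsN k (single u) n) ≡ count (extN k suc j) (var n) + count k (var n) * occ j (shiftN k u)
occ-subst-var u zero    zero    j       = sym (+-identityʳ (occ j u))
occ-subst-var u zero    (suc n) j       = sym (trans (+-identityʳ _) (count-var-suc n j))
occ-subst-var u (suc k) zero    zero    = refl
occ-subst-var u (suc k) zero    (suc j) = refl
occ-subst-var u (suc k) (suc n) zero
  rewrite occ-zero-shift (extsN k (single u) n) | occ-zero-shift (shiftN k u) =
  sym (*-zeroʳ (count (suc k) (var (suc n))))
occ-subst-var u (suc k) (suc n) (suc j)
  rewrite occ-suc-shift (extsN k (single u) n) j | occ-suc-shift (shiftN k u) j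
        | count-var-suc n (extN k suc j) | count-var-suc n k =
  occ-subst-var u k n j

affine-sum : ∀ a b c d w → (a + b * w) + (c + d * w) ≡ (a + c) + (b + d) * w
affine-sum = solve-∀

affine-sum-scaled : ∀ a b c d e w → (a + b * w) + c * (d + e * w) ≡ (a + c * d) + (b + c * e) * w
affine-sum-scaled = solve-∀

occ-subst : ∀ u t k j →
  occ j (subst (extsN k (single u)) t) ≡ occ (extN k suc j) t + occ k t * occ j (shiftN k u)
occ-zero-subst-exts : ∀ u t k → occ 0 (subst (extsN (suc k) (single u)) t) ≡ occ 0 t

occ-subst u (var n) k j = occ-subst-var u k n j
occ-subst u (lam t) k j
  rewrite occ-subst u t (suc k) (suc j) | occ-suc-shift (shiftN k u) j = refl
occ-subst u (app t v) k j
  rewrite occ-subst u t k j | occ-subst u v k j =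
  affine-sum (occ (extN k suc j) t) (occ k t) (occ (extN k suc j) v) (occ k v) (occ j (shiftN k u))
occ-subst u (sub t v) k j
  rewrite occ-subst u t (suc k) (suc j) | occ-suc-shift (shiftN k u) j
        | occ-zero-subst-exts u t k | occ-subst u v k j =
  affine-sum-scaled (occ (suc (extN k suc j)) t) (occ (suc k) t) (1 ⊔ occ 0 t)
                    (occ (extN k suc j) v) (occ k v) (occ j (shiftN k u))

occ-zero-subst-exts u t k
  rewrite occ-subst u t (suc k) 0 | occ-zero-shift (shiftN k u)
        | *-zeroʳ (occ (suc k) t) = +-identityʳ (occ 0 t)

μ-subst-var : ∀ u k n → μ (extsN k (single u) n) ≡ count k (var n) * μ (shiftN k u)
μ-subst-var u zero    zero    = sym (+-identityʳ (μ u))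
μ-subst-var u zero    (suc n) = refl
μ-subst-var u (suc k) zero    = refl
μ-subst-var u (suc k) (suc n)
  rewrite μ-shift (extsN k (single u) n) | μ-shift (shiftN k u) | count-var-suc n k =
  μ-subst-var u k n

μ-subst : ∀ u t k → μ (subst (extsN k (single u)) t) ≡ μ t + occSq k t * μ (shiftN k u)
μ-subst u (var n) k = μ-subst-var u k n
μ-subst u (lam t) k
  rewrite μ-subst u t (suc k) | μ-shift (shiftN k u) = refl
μ-subst u (app t v) k
  rewrite μ-subst u t k | μ-subst u v k =
  affine-sum (μ t) (occSq k t) (μ v) (occSq k v) (μ (shiftN k u))
μ-subst u (sub t v) k
  rewrite μ-subst u t (suc k) | μ-shift (shiftN k u)
        | occ-zero-subst-exts u t k | μ-subst u v k =
  affine-sum-scaled (μ t) (occSq (suc k) t) ((1 ⊔ occ 0 t) ²)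
                    (suc (μ v)) (occSq k v) (μ (shiftN k u))

occSq≤occ² : ∀ k t → occSq k t ≤ (occ k t) ²
occSq≤occ² k (var n)   = n≤n² (count k (var n))
occSq≤occ² k (lam t)   = occSq≤occ² (suc k) t
occSq≤occ² k (app t u) =
  ≤-trans (+-mono-≤ (occSq≤occ² k t) (occSq≤occ² k u)) (²-+-≤ (occ k t) (occ k u))
occSq≤occ² k (sub t u) = begin
  occSq (suc k) t + c ² * occSq k u
    ≤⟨ +-mono-≤ (occSq≤occ² (suc k) t) (*-monoʳ-≤ (c ²) (occSq≤occ² k u)) ⟩
  (occ (suc k) t) ² + c ² * (occ k u) ² ≡⟨ cong ((occ (suc k) t) ² +_) (²-* c (occ k u)) ⟩
  (occ (suc k) t) ² + (c * occ k u) ²   ≤⟨ ²-+-≤ (occ (suc k) t) (c * occ k u) ⟩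
  (occ (suc k) t + c * occ k u) ²       ∎
  where
  open ≤-Reasoning
  c = 1 ⊔ occ 0 t
  ²-* : ∀ a b → a * a * (b * b) ≡ (a * b) * (a * b)
  ²-* = solve-∀

skip : ℕ → Ren
skip k = extN k (ext suc)

skip-fixes : ∀ k → skip k k ≡ k
skip-fixes zero    = refl
skip-fixes (suc k) = cong suc (skip-fixes k)

skip-avoids : ∀ k n → skip k n ≢ suc k
skip-avoids zero    zero    ()
skip-avoids zero    (suc n) ()
skip-avoids (suc k) zero    ()
skip-avoids (suc k) (suc n) e = skip-avoids k n (suc-injective e)

skip-injective : ∀ k → Injective _≡_ _≡_ (skip k)
skip-injective k = extN-injective k (ext-injective suc-injective)

count-var-skip : ∀ k n → count k (var (skip k n)) ≡ count k (var n)
count-var-skip k n =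
  trans (cong (λ k′ → count k′ (var (skip k n))) (sym (skip-fixes k)))
        (count-var-rename (skip-injective k) n k)

split-count-renamed : ∀ {k t t′ i} → Split k t t′ i → count (suc k) t′ ≡ i
split-count-renamed {k} (sp-keep {n = n}) = count-var-other (skip-avoids k n)
split-count-renamed {k} sp-ren            = count-var-self (suc k)
split-count-renamed (sp-lam s)            = split-count-renamed s
split-count-renamed (sp-app s r)          = cong₂ _+_ (split-count-renamed s) (split-count-renamed r)
split-count-renamed (sp-sub s r)          = cong₂ _+_ (split-count-renamed s) (split-count-renamed r)

split-count-kept : ∀ {k t t′ i} → Split k t t′ i → count k t ≡ i + count k t′
split-count-kept {k} (sp-keep {n = n}) = sym (count-var-skip k n)
split-count-kept {k} sp-ren            =
  trans (count-var-self k) (cong suc (sym (count-var-other (1+n≢n {k}))))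
split-count-kept (sp-lam s)            = split-count-kept s
split-count-kept (sp-app {i = i} {j} s r)
  rewrite split-count-kept s | split-count-kept r = +-interchange i _ j _
split-count-kept (sp-sub {i = i} {j} s r)
  rewrite split-count-kept s | split-count-kept r = +-interchange i _ j _

split-occ-other : ∀ {k t t′ i} → Split k t t′ i → ∀ j → j ≢ k → occ (skip k j) t′ ≡ occ j t
split-occ-other {k} (sp-keep {n = n}) j j≢k = count-var-rename (skip-injective k) n j
split-occ-other {k} sp-ren            j j≢k =
  trans (count-var-other (skip-avoids k j ∘ sym)) (sym (count-var-other (j≢k ∘ sym)))
split-occ-other (sp-lam s)   j j≢k = split-occ-other s (suc j) (j≢k ∘ suc-injective)
split-occ-other (sp-app s r) j j≢k = cong₂ _+_ (split-occ-other s j j≢k) (split-occ-other r j j≢k)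
split-occ-other (sp-sub s r) j j≢k
  rewrite split-occ-other s (suc j) (j≢k ∘ suc-injective) | split-occ-other s 0 (λ ())
        | split-occ-other r j j≢k = refl

split-occ : ∀ {k t t′ i} → Split k t t′ i → occ k t ≡ occ k t′ + occ (suc k) t′
split-occ {k} (sp-keep {n = n})
  rewrite count-var-skip k n | count-var-other (skip-avoids k n) = sym (+-identityʳ _)
split-occ {k} sp-ren
  rewrite count-var-self k | count-var-other (1+n≢n {k}) | count-var-self (suc k) = refl
split-occ (sp-lam s) = split-occ s
split-occ (sp-app {t' = t′} {u' = u′} s r)
  rewrite split-occ s | split-occ r = +-interchange (occ _ t′) _ (occ _ u′) _
split-occ {k} (sp-sub {t = t} {t' = t′} {u' = u′} s r)
  rewrite split-occ s | split-occ r | split-occ-other s 0 (λ ()) =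
  distrib (occ (suc k) t′) (occ (suc (suc k)) t′) (1 ⊔ occ 0 t) (occ k u′) (occ (suc k) u′)
  where
  distrib : ∀ a b c d e → (a + b) + c * (d + e) ≡ (a + c * d) + (b + c * e)
  distrib = solve-∀

split-μ : ∀ {k t t′ i} → Split k t t′ i → μ t′ ≡ μ t
split-μ sp-keep      = refl
split-μ sp-ren       = refl
split-μ (sp-lam s)   = split-μ s
split-μ (sp-app s r) = cong₂ _+_ (split-μ s) (split-μ r)
split-μ (sp-sub s r)
  rewrite split-μ s | split-μ r | split-occ-other s 0 (λ ()) = refl

-- Invariance under ≡obox

infix 4 _≃_

record _≃_ (t t′ : Term) : Set where
  field
    μ-≡   : μ t ≡ μ t′
    occ-≡ : ∀ j → occ j t ≡ occ j t′
open _≃_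

≃-isEquivalence : IsEquivalence _≃_
≃-isEquivalence = record
  { refl  = record { μ-≡ = refl ; occ-≡ = λ _ → refl }
  ; sym   = λ e → record { μ-≡ = sym (μ-≡ e) ; occ-≡ = sym ∘ occ-≡ e }
  ; trans = λ e f → record
      { μ-≡ = trans (μ-≡ e) (μ-≡ f) ; occ-≡ = λ j → trans (occ-≡ e j) (occ-≡ f j) }
  }

occ-zero-swap : ∀ t → occ 0 (swap01 t) ≡ occ 1 t
occ-zero-swap t = occ-rename swapR-injective t 1

occ-one-swap : ∀ t → occ 1 (swap01 t) ≡ occ 0 t
occ-one-swap t = occ-rename swapR-injective t 0

occ-suc-suc-swap : ∀ t j → occ (suc (suc j)) (swap01 t) ≡ occ (suc (suc j)) t
occ-suc-suc-swap t j = occ-rename swapR-injective t (suc (suc j))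

μ-swap : ∀ t → μ (swap01 t) ≡ μ t
μ-swap = μ-rename swapR-injective

occ-zero-sub-shift : ∀ t s → occ 0 (sub t (shift s)) ≡ occ 1 t
occ-zero-sub-shift t s
  rewrite occ-zero-shift s | *-zeroʳ (1 ⊔ occ 0 t) = +-identityʳ (occ 1 t)

exch-≃ : ∀ t s v → sub (sub t (shift s)) v ≃ sub (sub (swap01 t) (shift v)) s
exch-≃ t s v = record { μ-≡ = μ-eq ; occ-≡ = occ-eq }
  where
  μ-eq : μ (sub (sub t (shift s)) v) ≡ μ (sub (sub (swap01 t) (shift v)) s)
  μ-eq rewrite occ-zero-sub-shift t s | occ-zero-sub-shift (swap01 t) v
             | occ-zero-swap t | occ-one-swap t | μ-swap t | μ-shift s | μ-shift v =
    +-rightComm (μ t) _ _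
  occ-eq : ∀ j → occ j (sub (sub t (shift s)) v) ≡ occ j (sub (sub (swap01 t) (shift v)) s)
  occ-eq j rewrite occ-zero-sub-shift t s | occ-zero-sub-shift (swap01 t) v
                 | occ-zero-swap t | occ-one-swap t | occ-suc-suc-swap t j
                 | occ-suc-shift s j | occ-suc-shift v j =
    +-rightComm (occ (suc (suc j)) t) _ _

lam-≃ : ∀ t s → lam (sub t (shift s)) ≃ sub (lam (swap01 t)) s
lam-≃ t s = record { μ-≡ = μ-eq ; occ-≡ = occ-eq }
  where
  μ-eq : μ (lam (sub t (shift s))) ≡ μ (sub (lam (swap01 t)) s)
  μ-eq rewrite occ-one-swap t | μ-swap t | μ-shift s = refl
  occ-eq : ∀ j → occ j (lam (sub t (shift s))) ≡ occ j (sub (lam (swap01 t)) s)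
  occ-eq j rewrite occ-one-swap t | occ-suc-suc-swap t j | occ-suc-shift s j = refl

appL-≃ : ∀ t s v → app (sub t s) v ≃ sub (app t (shift v)) s
appL-≃ t s v = record { μ-≡ = μ-eq ; occ-≡ = occ-eq }
  where
  μ-eq : μ (app (sub t s) v) ≡ μ (sub (app t (shift v)) s)
  μ-eq rewrite occ-zero-shift v | +-identityʳ (occ 0 t) | μ-shift v = +-rightComm (μ t) _ _
  occ-eq : ∀ j → occ j (app (sub t s) v) ≡ occ j (sub (app t (shift v)) s)
  occ-eq j rewrite occ-zero-shift v | +-identityʳ (occ 0 t) | occ-suc-shift v j =
    +-rightComm (occ (suc j) t) _ _

appR-≃ : ∀ t v u → sub (app (shift t) v) u ≃ app t (sub v u)
appR-≃ t v u = record { μ-≡ = μ-eq ; occ-≡ = occ-eq }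
  where
  μ-eq : μ (sub (app (shift t) v) u) ≡ μ (app t (sub v u))
  μ-eq rewrite occ-zero-shift t | μ-shift t = +-assoc (μ t) (μ v) _
  occ-eq : ∀ j → occ j (sub (app (shift t) v) u) ≡ occ j (app t (sub v u))
  occ-eq j rewrite occ-zero-shift t | occ-suc-shift t j = +-assoc (occ j t) (occ (suc j) v) _

box-≃ : ∀ t v u → 1 ≤ occ 0 v → sub (sub (rename (ext suc) t) v) u ≃ sub t (sub v u)
box-≃ t v u v-pos = record { μ-≡ = μ-eq ; occ-≡ = occ-eq }
  where
  ext-inj = ext-injective suc-injective
  b = 1 ⊔ occ 0 t
  c = occ 0 v
  occ-zero : occ 0 (rename (ext suc) t) ≡ occ 0 t
  occ-zero = occ-rename ext-inj t 0
  occ-one : occ 1 (rename (ext suc) t) ≡ 0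
  occ-one = occ-rename-avoiding t 1 λ { zero () ; (suc n) () }
  -- the side condition x ∈ fv(v) of the box axiom is needed exactly here
  copies : 1 ⊔ b * c ≡ b * (1 ⊔ c)
  copies = trans (m≤n⇒m⊔n≡n (*-mono-≤ (m≤m⊔n 1 (occ 0 t)) v-pos))
                 (cong (b *_) (sym (m≤n⇒m⊔n≡n v-pos)))
  μ-eq : μ (sub (sub (rename (ext suc) t) v) u) ≡ μ (sub t (sub v u))
  μ-eq rewrite occ-zero | occ-one | μ-rename ext-inj t | copies =
    nest (μ t) b (μ v) (1 ⊔ c) (μ u)
    where
    nest : ∀ m b v x u → (m + b * b * (1 + v)) + (b * x) * (b * x) * (1 + u)
                         ≡ m + b * b * (1 + (v + x * x * (1 + u)))
    nest = solve-∀
  occ-eq : ∀ j → occ j (sub (sub (rename (ext suc) t) v) u) ≡ occ j (sub t (sub v u))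
  occ-eq j rewrite occ-zero | occ-one | occ-rename ext-inj t (suc j) | copies =
    nest (occ (suc j) t) b (occ (suc j) v) (1 ⊔ c) (occ j u)
    where
    nest : ∀ m b v x u → (m + b * v) + (b * x) * u ≡ m + b * (v + x * u)
    nest = solve-∀

∼⇒≃ : ∀ {t t′} → t ∼ t′ → t ≃ t′
∼⇒≃ (ax-exch {t} {s} {v})    = exch-≃ t s v
∼⇒≃ (ax-lam {t} {s})         = lam-≃ t s
∼⇒≃ (ax-appL {t} {s} {v})    = appL-≃ t s v
∼⇒≃ (ax-appR {t} {v} {u} _)  = appR-≃ t v u
∼⇒≃ (ax-box {t} {v} {u} 0∈v) = box-≃ t v u (≤-trans 0∈v (count≤occ 0 v))

∼C⇒≃ : ∀ {t t′} → t ∼C t′ → t ≃ t′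
∼C⇒≃ (rootC r) = ∼⇒≃ r
∼C⇒≃ (lamC r)  = record { μ-≡ = μ-≡ e ; occ-≡ = occ-≡ e ∘ suc }
  where e = ∼C⇒≃ r
∼C⇒≃ (appL {u = u} r) = record
  { μ-≡ = cong (_+ μ u) (μ-≡ e) ; occ-≡ = λ j → cong (_+ occ j u) (occ-≡ e j) }
  where e = ∼C⇒≃ r
∼C⇒≃ (appR {t = t} r) = record
  { μ-≡ = cong (μ t +_) (μ-≡ e) ; occ-≡ = λ j → cong (occ j t +_) (occ-≡ e j) }
  where e = ∼C⇒≃ r
∼C⇒≃ (subL {u = u} r) = record
  { μ-≡   = cong₂ (λ m w → m + (1 ⊔ w) ² * suc (μ u)) (μ-≡ e) (occ-≡ e 0)
  ; occ-≡ = λ j → cong₂ (λ o w → o + (1 ⊔ w) * occ j u) (occ-≡ e (suc j)) (occ-≡ e 0)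
  }
  where e = ∼C⇒≃ r
∼C⇒≃ (subR {t = t} r) = record
  { μ-≡   = cong (λ m → μ t + (1 ⊔ occ 0 t) ² * suc m) (μ-≡ e)
  ; occ-≡ = λ j → cong (λ o → occ (suc j) t + (1 ⊔ occ 0 t) * o) (occ-≡ e j)
  }
  where e = ∼C⇒≃ r

≡obox⇒≃ : ∀ {t t′} → t ≡obox t′ → t ≃ t′
≡obox⇒≃ = fold ≃-isEquivalence ∼C⇒≃

-- Decrease along →j

infix 4 _≻_

record _≻_ (t t′ : Term) : Set where
  field
    μ-<   : μ t′ < μ t
    occ-≤ : ∀ j → occ j t′ ≤ occ j t
open _≻_

w-≻ : ∀ t u → sub (shift t) u ≻ t
w-≻ t u = record { μ-< = μ-lt ; occ-≤ = occ-le }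
  where
  μ-lt : μ t < μ (sub (shift t) u)
  μ-lt rewrite μ-shift t | occ-zero-shift t = m<m+n (μ t) (s≤s z≤n)
  occ-le : ∀ j → occ j t ≤ occ j (sub (shift t) u)
  occ-le j rewrite occ-suc-shift t j = m≤m+n (occ j t) _

d-≻ : ∀ t u → sub t u ≻ t ⟨0≔ u ⟩
d-≻ t u = record { μ-< = μ-lt ; occ-≤ = occ-le }
  where
  open ≤-Reasoning
  c = 1 ⊔ occ 0 t
  occ≤c : occ 0 t ≤ c
  occ≤c = m≤n⊔m 1 (occ 0 t)
  μ-lt : μ (t ⟨0≔ u ⟩) < μ (sub t u)
  μ-lt = begin-strict
    μ (t ⟨0≔ u ⟩)               ≡⟨ μ-subst u t 0 ⟩
    μ t + occSq 0 t * μ u       ≤⟨ +-monoʳ-≤ (μ t) (*-monoˡ-≤ (μ u) (occSq≤occ² 0 t)) ⟩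
    μ t + (occ 0 t) ² * μ u     ≤⟨ +-monoʳ-≤ (μ t) (*-monoˡ-≤ (μ u) (*-mono-≤ occ≤c occ≤c)) ⟩
    μ t + c ² * μ u             <⟨ +-monoʳ-< (μ t) ([1⊔m]²*-monoʳ-< (occ 0 t) (n<1+n (μ u))) ⟩
    μ t + c ² * suc (μ u)       ∎
  occ-le : ∀ j → occ j (t ⟨0≔ u ⟩) ≤ occ j (sub t u)
  occ-le j = begin
    occ j (t ⟨0≔ u ⟩)                   ≡⟨ occ-subst u t 0 j ⟩
    occ (suc j) t + occ 0 t * occ j u   ≤⟨ +-monoʳ-≤ (occ (suc j) t) (*-monoˡ-≤ (occ j u) occ≤c) ⟩
    occ (suc j) t + c * occ j u         ∎

c-≻ : ∀ {t t′ u i} → Split 0 t t′ i → 1 ≤ occ 0 t′ → 1 ≤ occ 1 t′ →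
      sub t u ≻ sub (sub t′ (shift u)) u
c-≻ {t} {t′} {u} s p-pos q-pos = record { μ-< = μ-lt ; occ-≤ = occ-le }
  where
  p = occ 0 t′
  q = occ 1 t′
  p+q-pos : 1 ≤ p + q
  p+q-pos = ≤-trans p-pos (m≤m+n p q)
  collect : ∀ a p q x → a + p * x + q * x ≡ a + (p + q) * x
  collect = solve-∀
  μ-lt : μ (sub (sub t′ (shift u)) u) < μ (sub t u)
  μ-lt rewrite occ-zero-sub-shift t′ u | μ-shift u | split-μ s | split-occ s
             | m≤n⇒m⊔n≡n p-pos | m≤n⇒m⊔n≡n q-pos | m≤n⇒m⊔n≡n p+q-pos = begin-strict
    μ t + p ² * U + q ² * U   ≡⟨ collect (μ t) (p ²) (q ²) U ⟩
    μ t + (p ² + q ²) * U     <⟨ +-monoʳ-< (μ t) (*-monoˡ-< U (²-+-< p-pos q-pos)) ⟩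
    μ t + (p + q) ² * U       ∎
    where
    open ≤-Reasoning
    U = suc (μ u)
  occ-le : ∀ j → occ j (sub (sub t′ (shift u)) u) ≤ occ j (sub t u)
  occ-le j rewrite occ-zero-sub-shift t′ u | occ-suc-shift u j | split-occ-other s (suc j) (λ ())
                 | split-occ s | m≤n⇒m⊔n≡n p-pos | m≤n⇒m⊔n≡n q-pos | m≤n⇒m⊔n≡n p+q-pos =
    ≤-reflexive (collect (occ (suc j) t) p q (occ j u))

remainder-pos : ∀ {n i r} → 1 < n → i ≤ n ∸ 1 → n ≡ i + r → 1 ≤ r
remainder-pos {zero}  {r = zero} () _ _
remainder-pos {suc n} {i} {zero} _ i≤n n≡i+0 =
  contradiction (≤-trans (≤-reflexive (trans n≡i+0 (+-identityʳ i))) i≤n) (n≮n n)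
remainder-pos {r = suc r} _ _ _ = s≤s z≤n

↦j⇒≻ : ∀ {t t′} → t ↦j t′ → t ≻ t′
↦j⇒≻ (rule-w {t} {u})   = w-≻ t u
↦j⇒≻ (rule-d {t} {u} _) = d-≻ t u
↦j⇒≻ (rule-c {t} {t′} {i = i} 1<count s 1≤i i≤count∸1) = c-≻ s kept-pos renamed-pos
  where
  kept-pos : 1 ≤ occ 0 t′
  kept-pos = ≤-trans (remainder-pos 1<count i≤count∸1 (split-count-kept s)) (count≤occ 0 t′)
  renamed-pos : 1 ≤ occ 1 t′
  renamed-pos = ≤-trans 1≤i (≡-subst (_≤ occ 1 t′) (split-count-renamed s) (count≤occ 1 t′))

→j⇒≻ : ∀ {t t′} → t →j t′ → t ≻ t′
→j⇒≻ (root r) = ↦j⇒≻ r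
→j⇒≻ (lamC r) = record { μ-< = μ-< d ; occ-≤ = occ-≤ d ∘ suc }
  where d = →j⇒≻ r
→j⇒≻ (appL {u = u} r) = record
  { μ-< = +-monoˡ-< (μ u) (μ-< d) ; occ-≤ = λ j → +-monoˡ-≤ (occ j u) (occ-≤ d j) }
  where d = →j⇒≻ r
→j⇒≻ (appR {t = t} r) = record
  { μ-< = +-monoʳ-< (μ t) (μ-< d) ; occ-≤ = λ j → +-monoʳ-≤ (occ j t) (occ-≤ d j) }
  where d = →j⇒≻ r
→j⇒≻ (subL {u = u} r) = record
  { μ-<   = +-mono-<-≤ (μ-< d) (*-monoˡ-≤ (suc (μ u)) ([1⊔-]²-mono (occ-≤ d 0)))
  ; occ-≤ = λ j → +-mono-≤ (occ-≤ d (suc j)) (*-monoˡ-≤ (occ j u) (⊔-monoʳ-≤ 1 (occ-≤ d 0)))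
  }
  where d = →j⇒≻ r
→j⇒≻ (subR {t = t} r) = record
  { μ-<   = +-monoʳ-< (μ t) ([1⊔m]²*-monoʳ-< (occ 0 t) (s≤s (μ-< d)))
  ; occ-≤ = λ j → +-monoʳ-≤ (occ (suc j) t) (*-monoʳ-≤ (1 ⊔ occ 0 t) (occ-≤ d j))
  }
  where d = →j⇒≻ r

→j/obox⇒μ-< : ∀ {t u} → t →j/obox u → μ u < μ t
→j/obox⇒μ-< {t} {u} (t′ , u′ , t≡t′ , t′→u′ , u′≡u) = begin-strict
  μ u   ≡⟨ μ-≡ (≡obox⇒≃ u′≡u) ⟨
  μ u′  <⟨ μ-< (→j⇒≻ t′→u′) ⟩
  μ t′  ≡⟨ μ-≡ (≡obox⇒≃ t≡t′) ⟨
  μ t   ∎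
  where open ≤-Reasoning

acc⇒noInfiniteDescent : ∀ {a ℓ} {A : Set a} {_<_ : Rel A ℓ} (f : ℕ → A) →
                        Acc _<_ (f 0) → ¬ InfiniteDescendingSequence _<_ f
acc⇒noInfiniteDescent f (acc rs) desc =
  acc⇒noInfiniteDescent (f ∘ suc) (rs (desc 0)) (desc ∘ suc)

measure⇒Terminating : ∀ {_⇒_ : Term → Term → Set} (m : Term → ℕ) →
                      (∀ {t u} → t ⇒ u → m u < m t) → Terminating _⇒_
measure⇒Terminating m decreasing (f , steps) =
  acc⇒noInfiniteDescent (m ∘ f) (<-wellFounded (m (f 0))) (λ n → decreasing (steps n))

corollary4p7 : Terminating _→j/obox_
corollary4p7 = measure⇒Terminating {_⇒_ = _→j/obox_} μ →j/obox⇒μ-<
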